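{- Let $d\ge 2$ and let $\mathcal{H}=(V,H)$ be a paving simplicial complex of dimension $d$. Then $$\mathrm{Fl}\,\mathcal{H} = P_{\le d-1}(V)\ \cup\ \{A\in P_d(V)\mid A\cup\{p\}\in H \text{ for every } p\in V\setminus A\}\ \cup\ \mathcal{L}^{(1)}_{\mathcal{H}}\ \cup\ \{V\}.$$
   Context: A simplicial complex is a pair $(V,H)$ with $V$ finite nonempty, $H\subseteq 2^V$ containing all singletons and closed under subsets; elements of $H$ are faces, maximal faces are facets, and the dimension is $\max\{|X|:X\in H\}-1$. $P_k(V)$, $P_{\le k}(V)$, $P_{\ge k}(V)$ denote the sets of subsets of $V$ with exactly, at most, at least $k$ elements. A complex of dimension $d$ is paving if $P_{\le d}(V)\subseteq H$. A subset $F\subseteq V$ is a flat if for every $X\in H$ with $X\subseteq F$ and every $p\in V\setminus F$ we have $X\cup\{p\}\in H$; $\mathrm{Fl}\,\mathcal{H}$ is the set of flats. A long hyperplane is an $X\in P_{\ge d+1}(V)$ containing no facet of $\mathcal{H}$; $\mathcal{L}_{\mathcal{H}}$ is the set of long hyperplanes maximal under inclusion, and $\mathcal{L}^{(1)}_{\mathcal{H}} = \{L\in\mathcal{L}_{\mathcal{H}}\cap\mathrm{Fl}\,\mathcal{H} \mid |L\cap L'|\le d-1 \text{ for every } L'\in\mathcal{L}_{\mathcal{H}}\setminus\{L\}\}$. -}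

module Defs where

open import Level using (0ℓ)
open import Data.Nat using (ℕ; suc; _≤_; _≥_; _∸_)
open import Data.Fin using (Fin)
open import Data.Fin.Subset using (Subset; _∈_; _∉_; _⊆_; _∪_; _∩_; ⁅_⁆; ∣_∣; ⊤)
open import Data.Product using (Σ; _×_; ∃)
open import Data.Sum using (_⊎_)
open import Relation.Nullary using (¬_; Dec)
open import Relation.Binary.PropositionalEquality using (_≡_)

-- A simplicial complex on the vertex set V = Fin n (finite; nonemptiness is
-- imposed in the theorem by taking n = suc m).  The family of faces H is a
-- predicate on subsets; it is decidable (as any family of subsets of a finite
-- set is, classically).
record SimplicialComplex (n : ℕ) : Set₁ where
  field
    H          : Subset n → Set
    H-dec      : (X : Subset n) → Dec (H X)
    singletons : (p : Fin n) → H ⁅ p ⁆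
    down       : {X Y : Subset n} → X ⊆ Y → H Y → H X

module _ {n : ℕ} (C : SimplicialComplex n) where
  open SimplicialComplex C

  HasDimension : ℕ → Set
  HasDimension d = (Σ (Subset n) λ X → H X × ∣ X ∣ ≡ suc d)
                 × ((X : Subset n) → H X → ∣ X ∣ ≤ suc d)

  Paving : ℕ → Set
  Paving d = HasDimension d × ((X : Subset n) → ∣ X ∣ ≤ d → H X)

  IsFlat : Subset n → Set
  IsFlat F = (X : Subset n) → H X → X ⊆ F → (p : Fin n) → p ∉ F → H (X ∪ ⁅ p ⁆)

  IsFacet : Subset n → Set
  IsFacet X = H X × ((Y : Subset n) → H Y → X ⊆ Y → Y ≡ X)

  IsLongHyperplane : ℕ → Subset n → Set
  IsLongHyperplane d X = ∣ X ∣ ≥ suc d × ((Y : Subset n) → IsFacet Y → ¬ (Y ⊆ X))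

  IsMaxLongHyperplane : ℕ → Subset n → Set
  IsMaxLongHyperplane d L = IsLongHyperplane d L
    × ((X : Subset n) → IsLongHyperplane d X → L ⊆ X → X ≡ L)

  IsL1 : ℕ → Subset n → Set
  IsL1 d L = IsMaxLongHyperplane d L × IsFlat L
    × ((L' : Subset n) → IsMaxLongHyperplane d L' → ¬ (L' ≡ L) → ∣ L ∩ L' ∣ ≤ d ∸ 1)

  InFlatDescription : ℕ → Subset n → Set
  InFlatDescription d F =
      ∣ F ∣ ≤ d ∸ 1
    ⊎ (∣ F ∣ ≡ d × ((p : Fin n) → p ∉ F → H (F ∪ ⁅ p ⁆)))
    ⊎ IsL1 d F
    ⊎ F ≡ ⊤

{-# OPTIONS --safe #-}
-- A flat F ≠ V with more than d points is a long hyperplane, since a facet inside F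
-- could be extended by a point outside F.  By paving, every d-subset A of F is a
-- face, so for q ∉ F the face A ∪ {q} has d + 1 points and is a facet; hence a long
-- hyperplane sharing d points with F lies inside F.  This gives the maximality of F
-- and the bound d - 1 on its intersections with the other maximal long hyperplanes.
-- Conversely, sets with fewer than d points are flats because every set of at most
-- d points is a face.
module Submission where

open import Defs
open import Data.Bool using (true; false) renaming (_≟_ to _≟ᵇ_)
open import Data.Empty using (⊥-elim)
open import Data.Fin using (Fin; zero; suc)
open import Data.Fin.Properties using (¬∀⟶∃¬)
open import Data.Fin.Subset
open import Data.Fin.Subset.Properties
open import Data.Nat using (ℕ; zero; suc; _≤_; _<_; s≤s; s≤s⁻¹)
open import Data.Nat.Properties
  using (≤-refl; ≤-trans; ≤-reflexive; n≤1+n; <-irrefl; _≤?_; _<?_; _≟_; ≰⇒>; ≮⇒≥;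
         ≤∧≢⇒<; <⇒≤pred; pred[m∸n]≡m∸[1+n])
open import Data.Product using (_×_; _,_; proj₁; proj₂; ∃)
open import Data.Sum using (inj₁; inj₂)
open import Data.Vec using ([]; _∷_)
open import Data.Vec.Properties using (≡-dec)
open import Function using (_∘_)
open import Function.Bundles using (_⇔_; mk⇔)
open import Relation.Nullary using (yes; no)
open import Relation.Nullary.Decidable using (_→-dec_)
open import Relation.Binary.PropositionalEquality using (_≡_; _≢_; refl; sym; cong; subst)

module _ {n : ℕ} where

  ⊈⇒∃∈∉ : {p q : Subset n} → p ⊈ q → ∃ λ x → x ∈ p × x ∉ q
  ⊈⇒∃∈∉ {p} {q} p⊈q
    with ¬∀⟶∃¬ n (λ x → x ∈ p → x ∈ q) (λ x → (x ∈? p) →-dec (x ∈? q)) (λ f → p⊈q (λ {x} → f x))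
  ... | x , ¬[x∈p⇒x∈q] with x ∈? p
  ...   | yes x∈p = x , x∈p , λ x∈q → ¬[x∈p⇒x∈q] (λ _ → x∈q)
  ...   | no  x∉p = ⊥-elim (¬[x∈p⇒x∈q] (⊥-elim ∘ x∉p))

  p≢⊤⇒∃∉ : {p : Subset n} → p ≢ ⊤ → ∃ λ x → x ∉ p
  p≢⊤⇒∃∉ {p} p≢⊤ = ¬∀⟶∃¬ n (_∈ p) (_∈? p) (λ f → p≢⊤ (⊆-antisym ⊆⊤ (λ {x} _ → f x)))

  p⊆q∧∣q∣≤∣p∣⇒p≡q : {p q : Subset n} → p ⊆ q → ∣ q ∣ ≤ ∣ p ∣ → p ≡ q
  p⊆q∧∣q∣≤∣p∣⇒p≡q {p} {q} p⊆q ∣q∣≤∣p∣ with q ⊆? p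
  ... | yes q⊆p = ⊆-antisym p⊆q q⊆p
  ... | no  q⊈p with ⊈⇒∃∈∉ q⊈p
  ...   | x , x∈q , x∉p = ⊥-elim (<-irrefl refl (≤-trans (p⊂q⇒∣p∣<∣q∣ (p⊆q , x , x∈q , x∉p)) ∣q∣≤∣p∣))

  p⊂p∪⁅x⁆ : {p : Subset n} {x : Fin n} → x ∉ p → p ⊂ p ∪ ⁅ x ⁆
  p⊂p∪⁅x⁆ {p} {x} x∉p = p⊆p∪q ⁅ x ⁆ , x , q⊆p∪q p ⁅ x ⁆ (x∈⁅x⁆ x) , x∉p

  p∪⁅x⁆⊆q : {p q : Subset n} {x : Fin n} → p ⊆ q → x ∈ q → p ∪ ⁅ x ⁆ ⊆ q
  p∪⁅x⁆⊆q {p} {x = x} p⊆q x∈q y∈p∪⁅x⁆ with x∈p∪q⁻ p ⁅ x ⁆ y∈p∪⁅x⁆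
  ... | inj₁ y∈p = p⊆q y∈p
  ... | inj₂ y∈⁅x⁆ = subst (_∈ _) (sym (x∈⁅y⁆⇒x≡y x y∈⁅x⁆)) x∈q

∣p∪⁅x⁆∣≤1+∣p∣ : {n : ℕ} (p : Subset n) (x : Fin n) → ∣ p ∪ ⁅ x ⁆ ∣ ≤ suc ∣ p ∣
∣p∪⁅x⁆∣≤1+∣p∣ (true  ∷ p) zero    rewrite ∪-identityʳ p = n≤1+n _
∣p∪⁅x⁆∣≤1+∣p∣ (false ∷ p) zero    rewrite ∪-identityʳ p = ≤-refl
∣p∪⁅x⁆∣≤1+∣p∣ (true  ∷ p) (suc x) = s≤s (∣p∪⁅x⁆∣≤1+∣p∣ p x)
∣p∪⁅x⁆∣≤1+∣p∣ (false ∷ p) (suc x) = ∣p∪⁅x⁆∣≤1+∣p∣ p x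

subset-of-size : {n : ℕ} (k : ℕ) (p : Subset n) → k ≤ ∣ p ∣ → ∃ λ q → q ⊆ p × ∣ q ∣ ≡ k
subset-of-size {n} zero    p       _ = ⊥ , ⊥-elim ∘ ∉⊥ , ∣⊥∣≡0 n
subset-of-size     (suc k) []      ()
subset-of-size     (suc k) (true  ∷ p) k<∣p∣ with subset-of-size k p (s≤s⁻¹ k<∣p∣)
... | q , q⊆p , ∣q∣≡k = true ∷ q , in⊆in q⊆p , cong suc ∣q∣≡k
subset-of-size     (suc k) (false ∷ p) k<∣p∣ with subset-of-size (suc k) p k<∣p∣
... | q , q⊆p , ∣q∣≡k = false ∷ q , out⊆ q⊆p , ∣q∣≡k

module _ {n : ℕ} (C : SimplicialComplex n) where
  open SimplicialComplex C

  ⊤-flat : IsFlat C ⊤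
  ⊤-flat _ _ _ _ x∉⊤ = ⊥-elim (x∉⊤ ∈⊤)

  flat-long-hyperplane : {d : ℕ} {F : Subset n} {x : Fin n} →
                         IsFlat C F → x ∉ F → suc d ≤ ∣ F ∣ → IsLongHyperplane C d F
  flat-long-hyperplane {x = x} flat x∉F d<∣F∣ = d<∣F∣ , facet-⊈
    where
    facet-⊈ : (Y : Subset n) → IsFacet C Y → Y ⊈ _
    facet-⊈ Y (face , maximal) Y⊆F = x∉F (Y⊆F x∈Y)
      where
      x∈Y : x ∈ Y
      x∈Y = subst (x ∈_) (maximal _ (flat Y face Y⊆F x x∉F) (p⊆p∪q ⁅ x ⁆))
                  (q⊆p∪q Y ⁅ x ⁆ (x∈⁅x⁆ x))

  module _ {d : ℕ} (paving : Paving C d) where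
    private
      face-bound : (X : Subset n) → H X → ∣ X ∣ ≤ suc d
      face-bound = proj₂ (proj₁ paving)

      small-face : (X : Subset n) → ∣ X ∣ ≤ d → H X
      small-face = proj₂ paving

    large-face-facet : {Y : Subset n} → H Y → suc d ≤ ∣ Y ∣ → IsFacet C Y
    large-face-facet face d<∣Y∣ =
      face , λ Z face-Z Y⊆Z → sym (p⊆q∧∣q∣≤∣p∣⇒p≡q Y⊆Z (≤-trans (face-bound Z face-Z) d<∣Y∣))

    small-face-∪⁅⁆ : {X : Subset n} (x : Fin n) → ∣ X ∣ < d → H (X ∪ ⁅ x ⁆)
    small-face-∪⁅⁆ {X} x ∣X∣<d = small-face _ (≤-trans (∣p∪⁅x⁆∣≤1+∣p∣ X x) ∣X∣<d)

    small-flat : {F : Subset n} → ∣ F ∣ < d → IsFlat C F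
    small-flat ∣F∣<d X _ X⊆F x _ = small-face-∪⁅⁆ x (≤-trans (s≤s (p⊆q⇒∣p∣≤∣q∣ X⊆F)) ∣F∣<d)

    -- Proper subsets X of F are faces with fewer than d points, so only X = F needs the hypothesis.
    size-d-flat : {F : Subset n} → ∣ F ∣ ≡ d → ((x : Fin n) → x ∉ F → H (F ∪ ⁅ x ⁆)) → IsFlat C F
    size-d-flat {F} ∣F∣≡d extends X _ X⊆F x x∉F with F ⊆? X
    ... | yes F⊆X = subst (λ Z → H (Z ∪ ⁅ x ⁆)) (⊆-antisym F⊆X X⊆F) (extends x x∉F)
    ... | no  F⊈X with ⊈⇒∃∈∉ F⊈X
    ...   | y , y∈F , y∉X =
            small-face-∪⁅⁆ x (≤-trans (p⊂q⇒∣p∣<∣q∣ (X⊆F , y , y∈F , y∉X)) (≤-reflexive ∣F∣≡d))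

    flat-extension-facet : {F A : Subset n} {x : Fin n} →
                           IsFlat C F → A ⊆ F → ∣ A ∣ ≡ d → x ∉ F → IsFacet C (A ∪ ⁅ x ⁆)
    flat-extension-facet {A = A} {x} flat A⊆F ∣A∣≡d x∉F =
      large-face-facet (flat A (small-face A (≤-reflexive ∣A∣≡d)) A⊆F x x∉F)
        (subst (λ k → suc k ≤ _) ∣A∣≡d (p⊂q⇒∣p∣<∣q∣ (p⊂p∪⁅x⁆ (x∉F ∘ A⊆F))))

    long-hyperplane-⊆-flat : {F S A : Subset n} → IsFlat C F → IsLongHyperplane C d S →
                             A ⊆ F → A ⊆ S → ∣ A ∣ ≡ d → S ⊆ F
    long-hyperplane-⊆-flat {F} {S} flat (_ , no-facet) A⊆F A⊆S ∣A∣≡d with S ⊆? F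
    ... | yes S⊆F = S⊆F
    ... | no  S⊈F with ⊈⇒∃∈∉ S⊈F
    ...   | x , x∈S , x∉F =
            ⊥-elim (no-facet _ (flat-extension-facet flat A⊆F ∣A∣≡d x∉F) (p∪⁅x⁆⊆q A⊆S x∈S))

    module _ {F : Subset n} {x : Fin n} (flat : IsFlat C F) (x∉F : x ∉ F) (d<∣F∣ : suc d ≤ ∣ F ∣) where
      private
        long : IsLongHyperplane C d F
        long = flat-long-hyperplane flat x∉F d<∣F∣

      flat-max-long-hyperplane : IsMaxLongHyperplane C d F
      flat-max-long-hyperplane = long , λ S long-S F⊆S →
        let A , A⊆F , ∣A∣≡d = subset-of-size d F (≤-trans (n≤1+n d) d<∣F∣)
        in ⊆-antisym (long-hyperplane-⊆-flat flat long-S A⊆F (F⊆S ∘ A⊆F) ∣A∣≡d) F⊆S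

      flat-meets-max-long-hyperplane : (L : Subset n) → IsMaxLongHyperplane C d L → L ≢ F →
                                       ∣ F ∩ L ∣ < d
      flat-meets-max-long-hyperplane L (long-L , maximal-L) L≢F with d ≤? ∣ F ∩ L ∣
      ... | no  d≰∣F∩L∣ = ≰⇒> d≰∣F∩L∣
      ... | yes d≤∣F∩L∣ =
            let A , A⊆F∩L , ∣A∣≡d = subset-of-size d (F ∩ L) d≤∣F∩L∣
                L⊆F = long-hyperplane-⊆-flat flat long-L (p∩q⊆p F L ∘ A⊆F∩L) (p∩q⊆q F L ∘ A⊆F∩L) ∣A∣≡d
            in ⊥-elim (L≢F (sym (maximal-L F long L⊆F)))

      flat-L1 : IsL1 C d F
      flat-L1 = flat-max-long-hyperplane , flat , λ L max-L L≢F →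
        subst (∣ F ∩ L ∣ ≤_) (pred[m∸n]≡m∸[1+n] d 0) (<⇒≤pred (flat-meets-max-long-hyperplane L max-L L≢F))

theorem5p6 : (m : ℕ) (C : SimplicialComplex (suc m)) (d : ℕ) → 2 ≤ d → Paving C d →
    (F : Subset (suc m)) → IsFlat C F ⇔ InFlatDescription C d F
theorem5p6 m C zero    ()
theorem5p6 m C (suc d) _  paving F = mk⇔ classify flat-of-description
  where
  classify : IsFlat C F → InFlatDescription C (suc d) F
  classify flat with ∣ F ∣ <? suc d
  ... | yes ∣F∣<d = inj₁ (s≤s⁻¹ ∣F∣<d)
  ... | no  ∣F∣≮d with ∣ F ∣ ≟ suc d
  ...   | yes ∣F∣≡d = inj₂ (inj₁ (∣F∣≡d , flat F (proj₂ paving F (≤-reflexive ∣F∣≡d)) ⊆-refl))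
  ...   | no  ∣F∣≢d with ≡-dec _≟ᵇ_ F ⊤
  ...     | yes F≡⊤ = inj₂ (inj₂ (inj₂ F≡⊤))
  ...     | no  F≢⊤ = inj₂ (inj₂ (inj₁ (flat-L1 C paving flat (proj₂ (p≢⊤⇒∃∉ F≢⊤)) d<∣F∣)))
    where
    d<∣F∣ : suc d < ∣ F ∣
    d<∣F∣ = ≤∧≢⇒< (≮⇒≥ ∣F∣≮d) (∣F∣≢d ∘ sym)

  flat-of-description : InFlatDescription C (suc d) F → IsFlat C F
  flat-of-description (inj₁ ∣F∣≤d∸1)                     = small-flat C paving (s≤s ∣F∣≤d∸1)
  flat-of-description (inj₂ (inj₁ (∣F∣≡d , extends)))    = size-d-flat C paving ∣F∣≡d extends
  flat-of-description (inj₂ (inj₂ (inj₁ (_ , flat , _)))) = flat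
  flat-of-description (inj₂ (inj₂ (inj₂ refl)))          = ⊤-flat C
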